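{- Let $G$ be a finite simple graph that is $3K_1$-free (i.e., $G$ contains no three pairwise non-adjacent vertices). If $\omega(G) = 4$ and $\Delta(G) \geq 7$, then $\chi(G) \leq \Delta(G) - 1$.
   Context: $\omega(G)$ denotes the clique number of $G$ (the size of a maximum clique), $\Delta(G)$ the maximum degree, and $\chi(G)$ the chromatic number. -}

module Defs where

open import Data.Nat using (ℕ; zero; suc; _⊔_; _∸_; _≤_)
open import Data.Sum using (_⊎_)
open import Data.Fin using (Fin)
open import Data.List using (List; filter; length; map; foldr; allFin)
open import Data.List.Relation.Unary.Unique.Propositional using (Unique)
open import Data.List.Relation.Unary.AllPairs using (AllPairs)
open import Data.Product using (Σ; _×_)
open import Relation.Nullary using (¬_; Dec)
open import Relation.Binary.PropositionalEquality using (_≡_)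
open import Level using (0ℓ)

record Graph (n : ℕ) : Set₁ where
  field
    Adj     : Fin n → Fin n → Set
    adj?    : ∀ u v → Dec (Adj u v)
    sym     : ∀ {u v} → Adj u v → Adj v u
    irrefl  : ∀ {u} → ¬ Adj u u

open Graph public

ThreeK1Free : ∀ {n} → Graph n → Set
ThreeK1Free {n} G =
  ∀ (u v w : Fin n) → ¬ (u ≡ v) → ¬ (u ≡ w) → ¬ (v ≡ w) →
  Adj G u v ⊎ (Adj G u w ⊎ Adj G v w)

IsClique : ∀ {n} → Graph n → List (Fin n) → Set
IsClique G xs = Unique xs × AllPairs (Adj G) xs

CliqueNumberIs : ∀ {n} → Graph n → ℕ → Set
CliqueNumberIs {n} G k =
  Σ (List (Fin n)) (λ xs → IsClique G xs × length xs ≡ k) ×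
  (∀ (xs : List (Fin n)) → IsClique G xs → length xs ≤ k)

degree : ∀ {n} → Graph n → Fin n → ℕ
degree {n} G v = length (filter (adj? G v) (allFin n))

maxDegree : ∀ {n} → Graph n → ℕ
maxDegree {n} G = foldr _⊔_ 0 (map (degree G) (allFin n))

ProperColouring : ∀ {n} → Graph n → (k : ℕ) → (Fin n → Fin k) → Set
ProperColouring {n} G k c = ∀ (u v : Fin n) → Adj G u v → ¬ (c u ≡ c v)

ChromaticAtMost : ∀ {n} → Graph n → ℕ → Set
ChromaticAtMost {n} G k = Σ (Fin n → Fin k) (ProperColouring G k)

module Submission where

-- A colour class of a 3K₁-free graph has at most two vertices, so a colouring is a cover of
-- the vertices by non-adjacent pairs. Let v have maximum degree Δ. Its non-neighbours form a
-- clique B, so |B| ≤ 4, and counting degrees each b ∈ B has at least |B| − 1 non-neighbours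
-- in N(v). Pair v with one vertex of B and the others greedily with distinct non-neighbours
-- in N(v); any five remaining neighbours of v span no K₄, hence contain two disjoint
-- non-adjacent pairs, and Δ − 1 classes suffice. Only Δ = 7, |B| = 4 with four neighbours
-- left over escapes this; then two of the four are non-adjacent, and the last two are
-- absorbed into the five pairs by an alternating path.

open import Data.Empty using (⊥; ⊥-elim)
open import Data.Fin using (Fin; zero; suc; inject≤)
open import Data.Fin.Properties using (inject≤-injective; suc-injective)
open import Data.List using (List; []; _∷_; _++_; length; filter; map; allFin; foldr)
open import Data.List.Membership.Propositional using (_∈_)
open import Data.List.Membership.Propositional.Properties
  using (∈-filter⁻; ∈-filter⁺; ∈-allFin; ∈-∃++; ∈-++⁺ˡ; ∈-++⁺ʳ; ∈-++⁻)
open import Data.List.Properties using (filter-all; filter-accept; filter-reject; filter-++; length-++; length-map; ++-assoc)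
open import Data.List.Relation.Binary.Permutation.Propositional
  using (_↭_; refl; prep; swap; trans; ↭-refl; ↭-reflexive; ↭-sym; ↭-trans; ↭-prep; ↭-swap; ↭⇒↭ₛ;
         module PermutationReasoning)
open import Data.List.Relation.Binary.Permutation.Propositional.Properties
  using (∈-resp-↭; All-resp-↭; ↭-length; filter-↭; shift; ++-comm; shifts; ++⁺; ++⁺ˡ; ++⁺ʳ)
import Data.List.Relation.Binary.Permutation.Setoid.Properties as SetoidPermutation
open import Data.List.Relation.Binary.Subset.Propositional using (_⊆_)
open import Data.List.Relation.Unary.All using (All; []; _∷_)
import Data.List.Relation.Unary.All as All
open import Data.List.Relation.Unary.All.Properties
  using (all-filter) renaming (++⁺ to All-++⁺; ++⁻ˡ to All-++⁻ˡ; ++⁻ʳ to All-++⁻ʳ; filter⁺ to All-filter⁺)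
open import Data.List.Relation.Unary.AllPairs using (AllPairs; []; _∷_)
import Data.List.Relation.Unary.AllPairs as AllPairs
open import Data.List.Relation.Unary.AllPairs.Properties using () renaming (take⁺ to AllPairs-take⁺)
open import Data.List.Relation.Unary.Any using (here; there)
open import Data.List.Relation.Unary.Unique.Propositional using (Unique)
open import Data.List.Relation.Unary.Unique.Propositional.Properties
  using (allFin⁺) renaming (filter⁺ to Unique-filter⁺)
open import Data.Nat using (ℕ; suc; _+_; _∸_; _≤_; _⊔_; z≤n; s≤s; s≤s⁻¹; _≤?_)
open import Data.Nat.Properties
  using (≤-refl; ≤-reflexive; ≤-trans; ≤-antisym; n≤1+n; ≰⇒>; +-comm; +-suc; +-mono-≤; +-monoˡ-≤; +-monoʳ-≤;
         +-cancelˡ-≤; +-cancelʳ-≤; +-∸-assoc; m≤m⊔n; m≤n⊔m; ⊔-sel; module ≤-Reasoning)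
open import Data.Product using (∃; ∃₂; _×_; _,_; proj₁; proj₂)
open import Data.Sum using (_⊎_; inj₁; inj₂; [_,_])
open import Relation.Nullary using (¬_; Dec; yes; no)
open import Relation.Nullary.Decidable using (_×-dec_)
open import Relation.Unary using (Pred; Decidable; _∪_)
open import Relation.Unary.Properties using (∁?; _∪?_)
open import Function using (_∘_)
open import Relation.Binary.PropositionalEquality
  using (_≡_; _≢_; refl; sym; cong; cong₂; subst; setoid; ≢-sym; module ≡-Reasoning)
import Relation.Binary.PropositionalEquality as ≡
open import Level using (0ℓ)

open import Defs renaming (sym to adj-sym)

module _ {A : Set} where

  ends : List (A × A) → List A
  ends [] = []
  ends ((p , q) ∷ ps) = p ∷ q ∷ ends ps

  Unique-resp-↭ : ∀ {xs ys : List A} → xs ↭ ys → Unique xs → Unique ys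
  Unique-resp-↭ σ = SetoidPermutation.Unique-resp-↭ (setoid A) (↭⇒↭ₛ σ)

  ends-++ : ∀ ps qs → ends (ps ++ qs) ≡ ends ps ++ ends qs
  ends-++ [] qs = refl
  ends-++ ((p , q) ∷ ps) qs = cong (λ es → p ∷ q ∷ es) (ends-++ ps qs)

  ends-↭ : ∀ {ps qs} → ps ↭ qs → ends ps ↭ ends qs
  ends-↭ refl = ↭-refl
  ends-↭ (prep (p , q) σ) = ↭-prep p (↭-prep q (ends-↭ σ))
  ends-↭ (swap (p , q) (p′ , q′) σ) =
    ↭-trans (shifts (p ∷ q ∷ []) (p′ ∷ q′ ∷ [])) (++⁺ˡ (p′ ∷ q′ ∷ p ∷ q ∷ []) (ends-↭ σ))
  ends-↭ (trans σ τ) = ↭-trans (ends-↭ σ) (ends-↭ τ)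

  map-proj₁++map-proj₂-↭-ends : ∀ ps → map proj₁ ps ++ map proj₂ ps ↭ ends ps
  map-proj₁++map-proj₂-↭-ends [] = ↭-refl
  map-proj₁++map-proj₂-↭-ends ((p , q) ∷ ps) = ↭-prep p (↭-trans
    (shift q (map proj₁ ps) (map proj₂ ps)) (↭-prep q (map-proj₁++map-proj₂-↭-ends ps)))

  Unique-++⁻ˡ : ∀ xs {ys : List A} → Unique (xs ++ ys) → Unique xs
  Unique-++⁻ˡ [] _ = []
  Unique-++⁻ˡ (x ∷ xs) (x∉ ∷ u) = All-++⁻ˡ xs x∉ ∷ Unique-++⁻ˡ xs u

  Unique-++⁻ʳ : ∀ xs {ys : List A} → Unique (xs ++ ys) → Unique ys
  Unique-++⁻ʳ [] u = u
  Unique-++⁻ʳ (x ∷ xs) (_ ∷ u) = Unique-++⁻ʳ xs u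

  ∃-∈-nonempty : ∀ (xs : List A) → 1 ≤ length xs → ∃ (_∈ xs)
  ∃-∈-nonempty (x ∷ _) _ = x , here refl

  module _ {P : Pred A 0ℓ} (P? : Decidable P) where

    length-filter-∷ : ∀ x xs → length (filter P? (x ∷ xs)) ≤ suc (length (filter P? xs))
    length-filter-∷ x xs with P? x
    ... | yes _ = ≤-refl
    ... | no _ = n≤1+n _

    length-filter-↭ : ∀ {xs ys} → xs ↭ ys → length (filter P? xs) ≡ length (filter P? ys)
    length-filter-↭ σ = ↭-length (filter-↭ P? σ)

    ↭-filter++filter-∁ : ∀ xs → xs ↭ filter P? xs ++ filter (∁? P?) xs
    ↭-filter++filter-∁ [] = ↭-refl
    ↭-filter++filter-∁ (x ∷ xs) with P? x
    ... | yes _ = ↭-prep x (↭-filter++filter-∁ xs)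
    ... | no _ = ↭-trans (↭-prep x (↭-filter++filter-∁ xs)) (↭-sym (shift x (filter P? xs) _))

    length-filter+length-filter-∁ : ∀ xs → length (filter P? xs) + length (filter (∁? P?) xs) ≡ length xs
    length-filter+length-filter-∁ xs =
      ≡.trans (sym (length-++ (filter P? xs))) (sym (↭-length (↭-filter++filter-∁ xs)))

  module _ {P Q : Pred A 0ℓ} (P? : Decidable P) (Q? : Decidable Q) where

    length-filter-∪ : ∀ xs → length (filter (P? ∪? Q?) xs) ≤ length (filter P? xs) + length (filter Q? xs)
    length-filter-∪ [] = z≤n
    length-filter-∪ (x ∷ xs) with P? x | Q? x
    ... | yes _ | yes _ = s≤s (≤-trans (length-filter-∪ xs) (+-monoʳ-≤ _ (n≤1+n _)))
    ... | yes _ | no _ = s≤s (length-filter-∪ xs)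
    ... | no _ | yes _ = ≤-trans (s≤s (length-filter-∪ xs)) (≤-reflexive (sym (+-suc _ _)))
    ... | no _ | no _ = length-filter-∪ xs

  module _ {R : A → A → Set} (R? : ∀ b → Decidable (R b)) where

    record Matching (bs as : List A) : Set where
      field
        pairs : List (A × A)
        related : All (λ (b , a) → R b a) pairs
        firsts : map proj₁ pairs ≡ bs
        unmatched : List A
        partition : as ↭ map proj₂ pairs ++ unmatched

      length-pairs : length pairs ≡ length bs
      length-pairs = ≡.trans (sym (length-map proj₁ pairs)) (cong length firsts)

      length-pairs+length-unmatched : length pairs + length unmatched ≡ length as
      length-pairs+length-unmatched = sym (begin
        length as                                    ≡⟨ ↭-length partition ⟩
        length (map proj₂ pairs ++ unmatched)        ≡⟨ length-++ (map proj₂ pairs) ⟩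
        length (map proj₂ pairs) + length unmatched  ≡⟨ cong (_+ length unmatched) (length-map proj₂ pairs) ⟩
        length pairs + length unmatched              ∎)
        where open ≡-Reasoning

      ++-↭-ends++unmatched : bs ++ as ↭ ends pairs ++ unmatched
      ++-↭-ends++unmatched = begin
        bs ++ as                                         ↭⟨ ++⁺ˡ bs partition ⟩
        bs ++ map proj₂ pairs ++ unmatched
          ≡⟨ cong (λ bs′ → bs′ ++ map proj₂ pairs ++ unmatched) firsts ⟨
        map proj₁ pairs ++ map proj₂ pairs ++ unmatched
          ≡⟨ ++-assoc (map proj₁ pairs) _ _ ⟨
        (map proj₁ pairs ++ map proj₂ pairs) ++ unmatched
          ↭⟨ ++⁺ʳ unmatched (map-proj₁++map-proj₂-↭-ends pairs) ⟩
        ends pairs ++ unmatched                          ∎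
        where open PermutationReasoning

      All-unmatched : ∀ {P : Pred A 0ℓ} → All P as → All P unmatched
      All-unmatched Pas = All-++⁻ʳ (map proj₂ pairs) (All-resp-↭ partition Pas)

      Unique-unmatched : Unique as → Unique unmatched
      Unique-unmatched u = Unique-++⁻ʳ (map proj₂ pairs) (Unique-resp-↭ partition u)

    -- Hall's condition in greedy form: if every b has |bs| partners, matching the first b
    -- leaves each remaining b′ at least |bs| − 1 partners.
    greedyMatching : ∀ bs as → (∀ {b} → b ∈ bs → length bs ≤ length (filter (R? b) as)) → Matching bs as
    greedyMatching [] as _ = record { pairs = [] ; related = [] ; firsts = refl ; unmatched = as ; partition = ↭-refl }
    greedyMatching (b ∷ bs) as enough = record
      { pairs = (b , a) ∷ pairs
      ; related = Rba ∷ related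
      ; firsts = cong (b ∷_) firsts
      ; unmatched = unmatched
      ; partition = ↭-trans (↭-reflexive as≡) (↭-trans (shift a ys zs) (↭-prep a partition))
      }
      where
      partner : ∃ (_∈ filter (R? b) as)
      partner = ∃-∈-nonempty (filter (R? b) as) (≤-trans (s≤s z≤n) (enough (here refl)))
      a : A
      a = proj₁ partner
      a∈as×Rba : a ∈ as × R b a
      a∈as×Rba = ∈-filter⁻ (R? b) (proj₂ partner)
      Rba : R b a
      Rba = proj₂ a∈as×Rba
      split : ∃₂ λ ys zs → as ≡ ys ++ a ∷ zs
      split = ∈-∃++ (proj₁ a∈as×Rba)
      ys zs : List A
      ys = proj₁ split
      zs = proj₁ (proj₂ split)
      as≡ : as ≡ ys ++ a ∷ zs
      as≡ = proj₂ (proj₂ split)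
      stillEnough : ∀ {b′} → b′ ∈ bs → length bs ≤ length (filter (R? b′) (ys ++ zs))
      stillEnough {b′} b′∈ = s≤s⁻¹ (begin
        suc (length bs)                             ≤⟨ enough (there b′∈) ⟩
        length (filter (R? b′) as)
          ≡⟨ length-filter-↭ (R? b′) (↭-trans (↭-reflexive as≡) (shift a ys zs)) ⟩
        length (filter (R? b′) (a ∷ ys ++ zs))      ≤⟨ length-filter-∷ (R? b′) a (ys ++ zs) ⟩
        suc (length (filter (R? b′) (ys ++ zs)))    ∎)
        where open ≤-Reasoning
      open Matching (greedyMatching bs (ys ++ zs) stillEnough)

p≤3∧r≤4∧7≤p+r⇒p≡3∧r≡4 : ∀ {p r} → p ≤ 3 → r ≤ 4 → 7 ≤ p + r → p ≡ 3 × r ≡ 4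
p≤3∧r≤4∧7≤p+r⇒p≡3∧r≡4 {p} {r} p≤3 r≤4 7≤p+r =
  ≤-antisym p≤3 (+-cancelʳ-≤ 4 3 p (≤-trans 7≤p+r (+-monoʳ-≤ p r≤4))) ,
  ≤-antisym r≤4 (+-cancelˡ-≤ 3 4 r (≤-trans 7≤p+r (+-monoˡ-≤ r p≤3)))

module _ {A : Set} (f : A → ℕ) where

  ≤-foldr-⊔ : ∀ {x xs} → x ∈ xs → f x ≤ foldr _⊔_ 0 (map f xs)
  ≤-foldr-⊔ {xs = y ∷ ys} (here refl) = m≤m⊔n (f y) _
  ≤-foldr-⊔ {xs = y ∷ ys} (there x∈) = ≤-trans (≤-foldr-⊔ x∈) (m≤n⊔m (f y) _)

  foldr-⊔-attained : ∀ xs → 1 ≤ foldr _⊔_ 0 (map f xs) → ∃ λ x → f x ≡ foldr _⊔_ 0 (map f xs)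
  foldr-⊔-attained (y ∷ ys) pos with ⊔-sel (f y) (foldr _⊔_ 0 (map f ys))
  ... | inj₁ eq = y , sym eq
  ... | inj₂ eq with x , fx≡ ← foldr-⊔-attained ys (subst (1 ≤_) eq pos) = x , ≡.trans fx≡ (sym eq)

module _ {n : ℕ} (G : Graph n) where

  infix 4 _~_ _≁_
  _~_ _≁_ : Fin n → Fin n → Set
  x ~ y = Adj G x y
  x ≁ y = ¬ Adj G x y

  NonAdjacent : Fin n × Fin n → Set
  NonAdjacent (p , q) = p ≁ q

  -- The pair (u , u) stands for the colour class {u}.
  record PairCover (k : ℕ) (us : List (Fin n)) : Set where
    field
      pairs : List (Fin n × Fin n)
      nonAdjacent : All NonAdjacent pairs
      size : length pairs ≤ k
      covers : us ⊆ ends pairs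

  pairsCover : ∀ {ps} → All NonAdjacent ps → PairCover (length ps) (ends ps)
  pairsCover {ps} na = record { pairs = ps ; nonAdjacent = na ; size = ≤-refl ; covers = λ u∈ → u∈ }

  pairCover : ∀ {p q} → p ≁ q → PairCover 1 (p ∷ q ∷ [])
  pairCover p≁q = pairsCover (p≁q ∷ [])

  singletonsCover : ∀ us → PairCover (length us) us
  singletonsCover [] = pairsCover []
  singletonsCover (u ∷ us) = record
    { pairs = (u , u) ∷ pairs
    ; nonAdjacent = irrefl G ∷ nonAdjacent
    ; size = s≤s size
    ; covers = λ { (here refl) → here refl ; (there u∈) → there (there (covers u∈)) }
    }
    where open PairCover (singletonsCover us)

  singletonCover : ∀ u → PairCover 1 (u ∷ [])
  singletonCover u = singletonsCover (u ∷ [])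

  infixr 5 _++ᶜ_
  _++ᶜ_ : ∀ {k l us vs} → PairCover k us → PairCover l vs → PairCover (k + l) (us ++ vs)
  C ++ᶜ D = record
    { pairs = C.pairs ++ D.pairs
    ; nonAdjacent = All-++⁺ C.nonAdjacent D.nonAdjacent
    ; size = ≤-trans (≤-reflexive (length-++ C.pairs)) (+-mono-≤ C.size D.size)
    ; covers = λ u∈ → subst (_ ∈_) (sym (ends-++ C.pairs D.pairs))
                              ([ ∈-++⁺ˡ ∘ C.covers , ∈-++⁺ʳ _ ∘ D.covers ] (∈-++⁻ _ u∈))
    }
    where
    module C = PairCover C
    module D = PairCover D

  cover-⊆ : ∀ {k us vs} → vs ⊆ us → PairCover k us → PairCover k vs
  cover-⊆ vs⊆us C = record { PairCover C ; covers = PairCover.covers C ∘ vs⊆us }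

  cover-↭ : ∀ {k us vs} → vs ↭ us → PairCover k us → PairCover k vs
  cover-↭ σ = cover-⊆ (∈-resp-↭ σ)

  cover-≤ : ∀ {k l us} → k ≤ l → PairCover k us → PairCover l us
  cover-≤ k≤l C = record { PairCover C ; size = ≤-trans (PairCover.size C) k≤l }

  pairIndex : ∀ (ps : List (Fin n × Fin n)) {u} → u ∈ ends ps → Fin (length ps)
  pairIndex (_ ∷ _) (here _) = zero
  pairIndex (_ ∷ _) (there (here _)) = zero
  pairIndex (_ ∷ ps) (there (there u∈)) = suc (pairIndex ps u∈)

  pairIndex-≁ : ∀ {ps : List (Fin n × Fin n)} → All NonAdjacent ps →
                ∀ {u w} (u∈ : u ∈ ends ps) (w∈ : w ∈ ends ps) → pairIndex ps u∈ ≡ pairIndex ps w∈ → u ≁ w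
  pairIndex-≁ (_ ∷ _) (here refl) (here refl) _ = irrefl G
  pairIndex-≁ (p≁q ∷ _) (here refl) (there (here refl)) _ = p≁q
  pairIndex-≁ (p≁q ∷ _) (there (here refl)) (here refl) _ = p≁q ∘ adj-sym G
  pairIndex-≁ (_ ∷ _) (there (here refl)) (there (here refl)) _ = irrefl G
  pairIndex-≁ (_ ∷ na) (there (there u∈)) (there (there w∈)) eq = pairIndex-≁ na u∈ w∈ (suc-injective eq)
  pairIndex-≁ (_ ∷ _) (here refl) (there (there w∈)) ()
  pairIndex-≁ (_ ∷ _) (there (here refl)) (there (there w∈)) ()
  pairIndex-≁ (_ ∷ _) (there (there u∈)) (here refl) ()
  pairIndex-≁ (_ ∷ _) (there (there u∈)) (there (here refl)) ()

  colouring : ∀ {k} → PairCover k (allFin n) → ChromaticAtMost G k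
  colouring C = colour , proper
    where
    open PairCover C
    colour : Fin n → Fin _
    colour u = inject≤ (pairIndex pairs (covers (∈-allFin u))) size
    proper : ProperColouring G _ colour
    proper u w u~w eq = pairIndex-≁ nonAdjacent _ _ (inject≤-injective size size _ _ eq) u~w

  degree-↭ : ∀ {u vs} → allFin n ↭ vs → degree G u ≡ length (filter (adj? G u) vs)
  degree-↭ {u} = length-filter-↭ (adj? G u)

  degree≤maxDegree : ∀ u → degree G u ≤ maxDegree G
  degree≤maxDegree u = ≤-foldr-⊔ (degree G) (∈-allFin u)

  maxDegree-attained : 1 ≤ maxDegree G → ∃ λ v → degree G v ≡ maxDegree G
  maxDegree-attained = foldr-⊔-attained (degree G) (allFin n)

  clique-unique : ∀ {xs} → AllPairs _~_ xs → Unique xs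
  clique-unique = AllPairs.map λ x~y x≡y → irrefl G (subst (_ ~_) (sym x≡y) x~y)

  length-filter-adj-clique : ∀ {x xs} → AllPairs _~_ xs → x ∈ xs → suc (length (filter (adj? G x) xs)) ≡ length xs
  length-filter-adj-clique (y~ys ∷ _) (here refl) =
    cong (suc ∘ length) (≡.trans (filter-reject (adj? G _) (irrefl G)) (filter-all (adj? G _) y~ys))
  length-filter-adj-clique {x} (y~ys ∷ clique) (there x∈) =
    ≡.trans (cong (suc ∘ length) (filter-accept (adj? G x) (adj-sym G (All.lookup y~ys x∈))))
            (cong suc (length-filter-adj-clique clique x∈))

  neighbours : Fin n → List (Fin n)
  neighbours v = filter (adj? G v) (allFin n)

  non-neighbours-split : ∀ v → ∃ λ B → (allFin n ↭ v ∷ B ++ neighbours v) × All (v ≁_) B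
  non-neighbours-split v with ys , zs , M≡ ← ∈-∃++ (∈-filter⁺ (∁? (adj? G v)) (∈-allFin v) (irrefl G)) =
    ys ++ zs , σ , All-++⁻ʳ (v ∷ []) (All-resp-↭ (shift v ys zs) v≁M)
    where
    M = filter (∁? (adj? G v)) (allFin n)
    σ : allFin n ↭ v ∷ (ys ++ zs) ++ neighbours v
    σ = begin
      allFin n                        ↭⟨ ↭-filter++filter-∁ (adj? G v) (allFin n) ⟩
      neighbours v ++ M               ↭⟨ ++-comm (neighbours v) M ⟩
      M ++ neighbours v               ≡⟨ cong (_++ neighbours v) M≡ ⟩
      (ys ++ v ∷ zs) ++ neighbours v  ↭⟨ ++⁺ʳ (neighbours v) (shift v ys zs) ⟩
      v ∷ (ys ++ zs) ++ neighbours v  ∎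
      where open PermutationReasoning
    v≁M : All (v ≁_) (ys ++ v ∷ zs)
    v≁M = subst (All (v ≁_)) M≡ (all-filter (∁? (adj? G v)) (allFin n))

  length-filter-∁-neighbours : ∀ {v B b} → allFin n ↭ v ∷ B ++ neighbours v → All (v ≁_) B → AllPairs _~_ B →
                               b ∈ B → degree G b ≤ degree G v →
                               length B ≤ suc (length (filter (∁? (adj? G b)) (neighbours v)))
  length-filter-∁-neighbours {v} {B} {b} σ v≁B clique b∈ deg≤ =
    subst (_≤ suc (missed N)) (length-filter-adj-clique clique b∈) (s≤s (+-cancelʳ-≤ (seen N) _ _ (begin
      seen B + seen N                                      ≡⟨ length-++ (filter (adj? G b) B) ⟨
      length (filter (adj? G b) B ++ filter (adj? G b) N)  ≡⟨ cong length (filter-++ (adj? G b) B N) ⟨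
      seen (B ++ N)                                        ≡⟨ cong length (filter-reject (adj? G b) b≁v) ⟨
      seen (v ∷ B ++ N)                                    ≡⟨ degree-↭ σ ⟨
      degree G b                                           ≤⟨ deg≤ ⟩
      length N                                             ≡⟨ length-filter+length-filter-∁ (adj? G b) N ⟨
      seen N + missed N                                    ≡⟨ +-comm (seen N) (missed N) ⟩
      missed N + seen N                                    ∎)))
    where
    open ≤-Reasoning
    N = neighbours v
    seen missed : List (Fin n) → ℕ
    seen xs = length (filter (adj? G b) xs)
    missed xs = length (filter (∁? (adj? G b)) xs)
    b≁v : b ≁ v
    b≁v = All.lookup v≁B b∈ ∘ adj-sym G

  degree-∷-∷ : ∀ {t t′ es} → allFin n ↭ t ∷ t′ ∷ es → t ~ t′ → degree G t ≡ suc (length (filter (adj? G t) es))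
  degree-∷-∷ {t} σ t~t′ = ≡.trans (degree-↭ σ)
    (cong length (≡.trans (filter-reject (adj? G t) (irrefl G)) (filter-accept (adj? G t) t~t′)))

  Both : Fin n → Fin n × Fin n → Set
  Both t (p , q) = t ~ p × t ~ q

  both? : ∀ t → Decidable (Both t)
  both? t (p , q) = adj? G t p ×-dec adj? G t q

  length-filter-adj-ends : ∀ {t} ps → All (λ (p , q) → t ~ p ⊎ t ~ q) ps →
                           length (filter (adj? G t) (ends ps)) ≡ length ps + length (filter (both? t) ps)
  length-filter-adj-ends [] [] = refl
  length-filter-adj-ends {t} ((p , q) ∷ ps) (sees ∷ sees*) with adj? G t p
  ... | yes _ with adj? G t q
  ...   | yes _ = cong suc (≡.trans (cong suc (length-filter-adj-ends ps sees*)) (sym (+-suc _ _)))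
  ...   | no _ = cong suc (length-filter-adj-ends ps sees*)
  length-filter-adj-ends {t} ((p , q) ∷ ps) (sees ∷ sees*) | no t≁p with adj? G t q
  ...   | yes _ = cong suc (length-filter-adj-ends ps sees*)
  ...   | no t≁q = ⊥-elim ([ t≁p , t≁q ] sees)

  module _ (3K₁-free : ThreeK1Free G) (ω≤4 : ∀ xs → IsClique G xs → length xs ≤ 4) where

    ≁∧≁⇒~ : ∀ {x y u} → x ≢ y → x ≢ u → y ≢ u → x ≁ y → x ≁ u → y ~ u
    ≁∧≁⇒~ x≢y x≢u y≢u x≁y x≁u with 3K₁-free _ _ _ x≢y x≢u y≢u
    ... | inj₁ x~y = ⊥-elim (x≁y x~y)
    ... | inj₂ (inj₁ x~u) = ⊥-elim (x≁u x~u)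
    ... | inj₂ (inj₂ y~u) = y~u

    ¬K₅ : ∀ {a b c d e} → a ~ b → a ~ c → a ~ d → a ~ e → b ~ c → b ~ d → b ~ e → c ~ d → c ~ e → d ~ e → ⊥
    ¬K₅ ab ac ad ae bc bd be cd ce de = 5≰4 (ω≤4 _ (clique-unique K₅ , K₅))
      where
      K₅ = (ab ∷ ac ∷ ad ∷ ae ∷ []) ∷ (bc ∷ bd ∷ be ∷ []) ∷ (cd ∷ ce ∷ []) ∷ (de ∷ []) ∷ [] ∷ []
      5≰4 : ¬ 5 ≤ 4
      5≰4 (s≤s (s≤s (s≤s (s≤s ()))))

    nonAdjacentPair : ∀ {v a b c d} → All (v ~_) (a ∷ b ∷ c ∷ d ∷ []) →
                      ∃₂ λ x y → ∃₂ λ z w → (a ∷ b ∷ c ∷ d ∷ [] ↭ x ∷ y ∷ z ∷ w ∷ []) × x ≁ y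
    nonAdjacentPair {a = a} {b} {c} {d} (va ∷ vb ∷ vc ∷ vd ∷ [])
      with adj? G a b | adj? G a c | adj? G a d | adj? G b c | adj? G b d | adj? G c d
    ... | no a≁b | _ | _ | _ | _ | _ = a , b , c , d , ↭-refl , a≁b
    ... | yes _ | no a≁c | _ | _ | _ | _ = a , c , b , d , ↭-prep a (↭-swap b c ↭-refl) , a≁c
    ... | yes _ | yes _ | no a≁d | _ | _ | _ = a , d , b , c , ↭-prep a (shift d (b ∷ c ∷ []) []) , a≁d
    ... | yes _ | yes _ | yes _ | no b≁c | _ | _ = b , c , a , d , ↭-sym (shift a (b ∷ c ∷ []) (d ∷ [])) , b≁c
    ... | yes _ | yes _ | yes _ | yes _ | no b≁d | _ =
      b , d , a , c , ↭-trans (↭-swap a b ↭-refl) (↭-prep b (shift d (a ∷ c ∷ []) [])) , b≁d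
    ... | yes _ | yes _ | yes _ | yes _ | yes _ | no c≁d = c , d , a , b , shifts (a ∷ b ∷ []) (c ∷ d ∷ []) , c≁d
    ... | yes ab | yes ac | yes ad | yes bc | yes bd | yes cd = ⊥-elim (¬K₅ va vb vc vd ab ac ad bc bd cd)

    wlog : ∀ {v k xs ys} → xs ↭ ys → (All (v ~_) ys → Unique ys → PairCover k ys) →
           All (v ~_) xs → Unique xs → PairCover k xs
    wlog σ cover vs u = cover-↭ σ (cover (All-resp-↭ σ vs) (Unique-resp-↭ σ u))

    -- Neighbours of a common vertex span no K₄, as ω ≤ 4.
    fiveNeighboursCover-path : ∀ {v a b c d e} → All (v ~_) (a ∷ b ∷ c ∷ d ∷ e ∷ []) →
                               Unique (a ∷ b ∷ c ∷ d ∷ e ∷ []) →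
                               a ≁ b → a ≁ c → c ~ d → c ~ e → d ~ e → PairCover 3 (a ∷ b ∷ c ∷ d ∷ e ∷ [])
    fiveNeighboursCover-path {a = a} {b} {c} {d} {e} (_ ∷ vb ∷ vc ∷ vd ∷ ve ∷ []) ((a≢b ∷ a≢c ∷ _) ∷ (b≢c ∷ _) ∷ _)
                             a≁b a≁c c~d c~e d~e
      with adj? G b d | adj? G b e
    ... | no b≁d | _ =
      cover-↭ (↭-prep a (↭-swap b c ↭-refl)) (pairCover a≁c ++ᶜ pairCover b≁d ++ᶜ singletonCover e)
    ... | yes _ | no b≁e =
      cover-↭ (↭-prep a (↭-swap b c (↭-swap d e ↭-refl)))
              (pairCover a≁c ++ᶜ pairCover b≁e ++ᶜ singletonCover d)
    ... | yes b~d | yes b~e = ⊥-elim (¬K₅ vb vc vd ve (≁∧≁⇒~ a≢b a≢c b≢c a≁b a≁c) b~d b~e c~d c~e d~e)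

    fiveNeighboursCover-nonAdjacent : ∀ {v a b c d e} → All (v ~_) (a ∷ b ∷ c ∷ d ∷ e ∷ []) →
                                      Unique (a ∷ b ∷ c ∷ d ∷ e ∷ []) →
                                      a ≁ b → PairCover 3 (a ∷ b ∷ c ∷ d ∷ e ∷ [])
    fiveNeighboursCover-nonAdjacent {a = a} {b} {c} {d} {e} vs@(va ∷ _ ∷ vc ∷ vd ∷ ve ∷ []) u a≁b
      with adj? G c d | adj? G c e | adj? G d e
    ... | no c≁d | _ | _ = pairCover a≁b ++ᶜ pairCover c≁d ++ᶜ singletonCover e
    ... | yes _ | no c≁e | _ =
      cover-↭ (↭-prep a (↭-prep b (↭-prep c (↭-swap d e ↭-refl))))
              (pairCover a≁b ++ᶜ pairCover c≁e ++ᶜ singletonCover d)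
    ... | yes _ | yes _ | no d≁e =
      cover-↭ (↭-prep a (↭-prep b (↭-sym (shift c (d ∷ e ∷ []) []))))
              (pairCover a≁b ++ᶜ pairCover d≁e ++ᶜ singletonCover c)
    ... | yes c~d | yes c~e | yes d~e with adj? G a c | adj? G a d | adj? G a e
    ... | no a≁c | _ | _ = fiveNeighboursCover-path vs u a≁b a≁c c~d c~e d~e
    ... | yes _ | no a≁d | _ =
      wlog (↭-prep a (↭-prep b (↭-swap c d ↭-refl)))
           (λ vs′ u′ → fiveNeighboursCover-path vs′ u′ a≁b a≁d (adj-sym G c~d) d~e c~e) vs u
    ... | yes _ | yes _ | no a≁e =
      wlog (↭-prep a (↭-prep b (shift e (c ∷ d ∷ []) [])))
           (λ vs′ u′ → fiveNeighboursCover-path vs′ u′ a≁b a≁e (adj-sym G c~e) (adj-sym G d~e) c~d) vs u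
    ... | yes a~c | yes a~d | yes a~e = ⊥-elim (¬K₅ va vc vd ve a~c a~d a~e c~d c~e d~e)

    fiveNeighboursCover : ∀ {v a b c d e} → All (v ~_) (a ∷ b ∷ c ∷ d ∷ e ∷ []) →
                          Unique (a ∷ b ∷ c ∷ d ∷ e ∷ []) → PairCover 3 (a ∷ b ∷ c ∷ d ∷ e ∷ [])
    fiveNeighboursCover {e = e} vs@(va ∷ vb ∷ vc ∷ vd ∷ _) u
      with _ , _ , _ , _ , σ , x≁y ← nonAdjacentPair (va ∷ vb ∷ vc ∷ vd ∷ []) =
      wlog (++⁺ʳ (e ∷ []) σ) (λ vs′ u′ → fiveNeighboursCover-nonAdjacent vs′ u′ x≁y) vs u

    neighbourhoodCover : ∀ {v} xs → All (v ~_) xs → Unique xs → 5 ≤ length xs → PairCover (length xs ∸ 2) xs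
    neighbourhoodCover [] _ _ ()
    neighbourhoodCover (_ ∷ []) _ _ (s≤s ())
    neighbourhoodCover (_ ∷ _ ∷ []) _ _ (s≤s (s≤s ()))
    neighbourhoodCover (_ ∷ _ ∷ _ ∷ []) _ _ (s≤s (s≤s (s≤s ())))
    neighbourhoodCover (_ ∷ _ ∷ _ ∷ _ ∷ []) _ _ (s≤s (s≤s (s≤s (s≤s ()))))
    neighbourhoodCover (_ ∷ _ ∷ _ ∷ _ ∷ _ ∷ rest) (va ∷ vb ∷ vc ∷ vd ∷ ve ∷ _) u _ =
      fiveNeighboursCover (va ∷ vb ∷ vc ∷ vd ∷ ve ∷ []) (AllPairs-take⁺ 5 u) ++ᶜ singletonsCover rest

    ~-other-end : ∀ {t p q} → t ≢ p → t ≢ q → p ≢ q → p ≁ q → t ≁ p → t ~ q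
    ~-other-end t≢p t≢q p≢q p≁q t≁p = adj-sym G (≁∧≁⇒~ p≢q (≢-sym t≢p) (≢-sym t≢q) p≁q (t≁p ∘ adj-sym G))

    sees-an-end : ∀ {t p q} → t ≢ p → t ≢ q → p ≢ q → p ≁ q → t ~ p ⊎ t ~ q
    sees-an-end {t} {p} t≢p t≢q p≢q p≁q with adj? G t p
    ... | yes t~p = inj₁ t~p
    ... | no t≁p = inj₂ (~-other-end t≢p t≢q p≢q p≁q t≁p)

    -- Absorbing an edge z ~ w into non-adjacent pairs ("slots") costs one class. By 3K₁-freeness
    -- z and w see an end of every slot, so the degree bound leaves three slots in which neither
    -- sees both ends. Such a slot either splits as {z, p}, {w, q}, or has an end c missed by both
    -- and an end q seen by both. Two of the latter with q ≁ q′ become {z, c}, {q, q′}, {c′, w},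
    -- and among three of them some q's are non-adjacent, as z, w and the three q's span no K₅.
    module Augmentation {z w : Fin n} (z~w : z ~ w) where

      Fresh : Fin n × Fin n → Set
      Fresh (p , q) = Unique (z ∷ w ∷ p ∷ q ∷ [])

      Slot : Fin n × Fin n → Set
      Slot s = NonAdjacent s × Fresh s

      Bad : Pred (Fin n × Fin n) 0ℓ
      Bad = Both z ∪ Both w

      bad? : Decidable Bad
      bad? = both? z ∪? both? w

      Common : Fin n × Fin n → Set
      Common (c , q) = z ≁ c × w ≁ c × z ~ q × w ~ q

      fresh-slots : ∀ ps → Unique (z ∷ w ∷ ends ps) → All Fresh ps
      fresh-slots [] _ = []
      fresh-slots ((p , q) ∷ ps) ((z≢w ∷ z≢p ∷ z≢q ∷ z∉) ∷ (w≢p ∷ w≢q ∷ w∉) ∷ (p≢q ∷ _) ∷ _ ∷ u) =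
        ((z≢w ∷ z≢p ∷ z≢q ∷ []) ∷ (w≢p ∷ w≢q ∷ []) ∷ (p≢q ∷ []) ∷ [] ∷ [])
        ∷ fresh-slots ps ((z≢w ∷ z∉) ∷ w∉ ∷ u)

      z-sees-an-end : ∀ {s} → Slot s → z ~ proj₁ s ⊎ z ~ proj₂ s
      z-sees-an-end (p≁q , (_ ∷ z≢p ∷ z≢q ∷ []) ∷ _ ∷ (p≢q ∷ []) ∷ _) = sees-an-end z≢p z≢q p≢q p≁q

      w-sees-an-end : ∀ {s} → Slot s → w ~ proj₁ s ⊎ w ~ proj₂ s
      w-sees-an-end (p≁q , _ ∷ (w≢p ∷ w≢q ∷ []) ∷ (p≢q ∷ []) ∷ _) = sees-an-end w≢p w≢q p≢q p≁q

      slots-↭ : ∀ {ps qs} → ps ↭ qs → z ∷ w ∷ ends ps ↭ z ∷ w ∷ ends qs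
      slots-↭ σ = ↭-prep z (↭-prep w (ends-↭ σ))

      Split : Fin n × Fin n → Set
      Split s = PairCover 2 (z ∷ w ∷ ends (s ∷ []))

      classify : ∀ {s} → Slot s → ¬ Bad s →
                 Split s ⊎ ∃ λ s′ → (ends (s ∷ []) ↭ ends (s′ ∷ [])) × NonAdjacent s′ × Common s′
      classify {p , q} (p≁q , (_ ∷ z≢p ∷ z≢q ∷ []) ∷ (w≢p ∷ w≢q ∷ []) ∷ (p≢q ∷ []) ∷ _) good
        with adj? G z p | adj? G z q | adj? G w p | adj? G w q
      ... | yes z~p | yes z~q | _ | _ = ⊥-elim (good (inj₁ (z~p , z~q)))
      ... | _ | _ | yes w~p | yes w~q = ⊥-elim (good (inj₂ (w~p , w~q)))
      ... | no z≁p | _ | _ | no w≁q =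
        inj₁ (cover-↭ (↭-prep z (↭-swap w p ↭-refl)) (pairCover z≁p ++ᶜ pairCover w≁q))
      ... | _ | no z≁q | no w≁p | _ =
        inj₁ (cover-↭ (↭-prep z (shift q (w ∷ p ∷ []) [])) (pairCover z≁q ++ᶜ pairCover w≁p))
      ... | no z≁p | _ | no w≁p | _ =
        inj₂ ((p , q) , ↭-refl , p≁q , z≁p , w≁p ,
              ~-other-end z≢p z≢q p≢q p≁q z≁p , ~-other-end w≢p w≢q p≢q p≁q w≁p)
      ... | _ | no z≁q | _ | no w≁q =
        inj₂ ((q , p) , ↭-swap p q ↭-refl , q≁p , z≁q , w≁q ,
              ~-other-end z≢q z≢p (≢-sym p≢q) q≁p z≁q , ~-other-end w≢q w≢p (≢-sym p≢q) q≁p w≁q)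
        where q≁p = p≁q ∘ adj-sym G

      commonPairCover : ∀ {s s′} → Common s → Common s′ → proj₂ s ≁ proj₂ s′ →
                        PairCover 3 (z ∷ w ∷ ends (s ∷ s′ ∷ []))
      commonPairCover {c , q} {c′ , q′} (z≁c , _) (_ , w≁c′ , _) q≁q′ =
        cover-↭ (↭-prep z (↭-trans (↭-prep w (↭-prep c (↭-prep q (↭-swap c′ q′ ↭-refl))))
                                   (↭-sym (shift w (c ∷ q ∷ q′ ∷ c′ ∷ []) []))))
                (pairCover z≁c ++ᶜ pairCover q≁q′ ++ᶜ pairCover (w≁c′ ∘ adj-sym G))

      allCommonCover : ∀ {s₁ s₂ s₃} → All NonAdjacent (s₁ ∷ s₂ ∷ s₃ ∷ []) → All Common (s₁ ∷ s₂ ∷ s₃ ∷ []) →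
                       PairCover 4 (z ∷ w ∷ ends (s₁ ∷ s₂ ∷ s₃ ∷ []))
      allCommonCover {s₁@(_ , q₁)} {s₂@(_ , q₂)} {s₃@(_ , q₃)} (na₁ ∷ na₂ ∷ na₃ ∷ [])
                     (com₁@(_ , _ , z~q₁ , w~q₁) ∷ com₂@(_ , _ , z~q₂ , w~q₂) ∷
                      com₃@(_ , _ , z~q₃ , w~q₃) ∷ [])
        with adj? G q₁ q₂ | adj? G q₁ q₃ | adj? G q₂ q₃
      ... | no q₁≁q₂ | _ | _ = commonPairCover com₁ com₂ q₁≁q₂ ++ᶜ pairsCover (na₃ ∷ [])
      ... | yes _ | no q₁≁q₃ | _ =
        cover-↭ (slots-↭ (↭-prep s₁ (↭-swap s₂ s₃ ↭-refl)))
                (commonPairCover com₁ com₃ q₁≁q₃ ++ᶜ pairsCover (na₂ ∷ []))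
      ... | yes _ | yes _ | no q₂≁q₃ =
        cover-↭ (slots-↭ (↭-sym (shift s₁ (s₂ ∷ s₃ ∷ []) [])))
                (commonPairCover com₂ com₃ q₂≁q₃ ++ᶜ pairsCover (na₁ ∷ []))
      ... | yes q₁~q₂ | yes q₁~q₃ | yes q₂~q₃ =
        ⊥-elim (¬K₅ z~w z~q₁ z~q₂ z~q₃ w~q₁ w~q₂ w~q₃ q₁~q₂ q₁~q₃ q₂~q₃)

      threeSlotCover : ∀ {s₁ s₂ s₃} → All (λ s → Slot s × ¬ Bad s) (s₁ ∷ s₂ ∷ s₃ ∷ []) →
                       PairCover 4 (z ∷ w ∷ ends (s₁ ∷ s₂ ∷ s₃ ∷ []))
      threeSlotCover {s₁} {s₂} {s₃} ((sl₁ , g₁) ∷ (sl₂ , g₂) ∷ (sl₃ , g₃) ∷ [])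
        with classify sl₁ g₁ | classify sl₂ g₂ | classify sl₃ g₃
      ... | inj₁ split₁ | _ | _ = split₁ ++ᶜ pairsCover (proj₁ sl₂ ∷ proj₁ sl₃ ∷ [])
      ... | inj₂ _ | inj₁ split₂ | _ =
        cover-↭ (slots-↭ (↭-swap s₁ s₂ ↭-refl)) (split₂ ++ᶜ pairsCover (proj₁ sl₁ ∷ proj₁ sl₃ ∷ []))
      ... | inj₂ _ | inj₂ _ | inj₁ split₃ =
        cover-↭ (slots-↭ (shift s₃ (s₁ ∷ s₂ ∷ []) [])) (split₃ ++ᶜ pairsCover (proj₁ sl₁ ∷ proj₁ sl₂ ∷ []))
      ... | inj₂ (_ , σ₁ , na₁ , com₁) | inj₂ (_ , σ₂ , na₂ , com₂) | inj₂ (_ , σ₃ , na₃ , com₃) =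
        cover-↭ (↭-prep z (↭-prep w (++⁺ σ₁ (++⁺ σ₂ σ₃))))
                (allCommonCover (na₁ ∷ na₂ ∷ na₃ ∷ []) (com₁ ∷ com₂ ∷ com₃ ∷ []))

      goodSlotsCover : ∀ gs → All (λ s → Slot s × ¬ Bad s) gs → 3 ≤ length gs →
                       PairCover (suc (length gs)) (z ∷ w ∷ ends gs)
      goodSlotsCover [] _ ()
      goodSlotsCover (_ ∷ []) _ (s≤s ())
      goodSlotsCover (_ ∷ _ ∷ []) _ (s≤s (s≤s ()))
      goodSlotsCover (_ ∷ _ ∷ _ ∷ _) (g₁ ∷ g₂ ∷ g₃ ∷ gs) _ =
        threeSlotCover (g₁ ∷ g₂ ∷ g₃ ∷ []) ++ᶜ pairsCover (All.map (proj₁ ∘ proj₁) gs)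

      length-filter-both≤1 : ∀ {t t′ ps} → allFin n ↭ t ∷ t′ ∷ ends ps → t ~ t′ →
                             All (λ (p , q) → t ~ p ⊎ t ~ q) ps → degree G t ≤ 2 + length ps →
                             length (filter (both? t) ps) ≤ 1
      length-filter-both≤1 {t} {ps = ps} σ t~t′ sees deg≤ = +-cancelˡ-≤ (suc (length ps)) _ _ (begin
        suc (length ps + length (filter (both? t) ps))   ≡⟨ cong suc (length-filter-adj-ends ps sees) ⟨
        suc (length (filter (adj? G t) (ends ps)))       ≡⟨ degree-∷-∷ σ t~t′ ⟨
        degree G t                                       ≤⟨ deg≤ ⟩
        2 + length ps                                    ≡⟨ cong suc (+-comm 1 (length ps)) ⟩
        suc (length ps + 1)                              ∎)
        where open ≤-Reasoning

      augmentingCover : ∀ slots → All NonAdjacent slots → allFin n ↭ z ∷ w ∷ ends slots → 5 ≤ length slots →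
                        degree G z ≤ 2 + length slots → degree G w ≤ 2 + length slots →
                        PairCover (suc (length slots)) (allFin n)
      augmentingCover slots na σ 5≤ deg-z deg-w =
        cover-↭ (↭-trans σ (slots-↭ (↭-trans (↭-filter++filter-∁ bad? slots) (++-comm bad good))))
          (cover-≤ (≤-reflexive size≡) (cover-↭ (↭-reflexive (cong (λ es → z ∷ w ∷ es) (ends-++ good bad)))
            (goodSlotsCover good goodSlots 3≤good ++ᶜ pairsCover (All-filter⁺ bad? na))))
        where
        bad = filter bad? slots
        good = filter (∁? bad?) slots
        slot* : All Slot slots
        slot* = All.zip (na , fresh-slots slots (Unique-resp-↭ σ (allFin⁺ n)))
        goodSlots : All (λ s → Slot s × ¬ Bad s) good
        goodSlots = All.zip (All-filter⁺ (∁? bad?) slot* , all-filter (∁? bad?) slots)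
        bad≤2 : length bad ≤ 2
        bad≤2 = ≤-trans (length-filter-∪ (both? z) (both? w) slots) (+-mono-≤
          (length-filter-both≤1 σ z~w (All.map z-sees-an-end slot*) deg-z)
          (length-filter-both≤1 (↭-trans σ (↭-swap z w ↭-refl)) (adj-sym G z~w)
                                (All.map w-sees-an-end slot*) deg-w))
        partition : length bad + length good ≡ length slots
        partition = length-filter+length-filter-∁ bad? slots
        3≤good : 3 ≤ length good
        3≤good = +-cancelˡ-≤ 2 3 _ (begin
          5                         ≤⟨ 5≤ ⟩
          length slots              ≡⟨ partition ⟨
          length bad + length good  ≤⟨ +-monoˡ-≤ _ bad≤2 ⟩
          2 + length good           ∎)
          where open ≤-Reasoning
        size≡ : suc (length good) + length bad ≡ suc (length slots)
        size≡ = cong suc (≡.trans (+-comm (length good) (length bad)) partition)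

    non-neighbours-clique : ∀ {v B} → All (v ≁_) B → Unique (v ∷ B) → AllPairs _~_ B
    non-neighbours-clique [] _ = []
    non-neighbours-clique (v≁b ∷ v≁B) ((v≢b ∷ v∉B) ∷ b∉B ∷ u) =
      All.zipWith (λ (v≢b′ , v≁b′ , b≢b′) → ≁∧≁⇒~ v≢b v≢b′ b≢b′ v≁b v≁b′) (v∉B , All.zip (v≁B , b∉B))
      ∷ non-neighbours-clique v≁B (v∉B ∷ u)

    absorbTwoVertices : ∀ {z w} slots → allFin n ↭ z ∷ w ∷ ends slots → All NonAdjacent slots → 5 ≤ length slots →
                       (∀ u → degree G u ≤ 2 + length slots) → PairCover (suc (length slots)) (allFin n)
    absorbTwoVertices {z} {w} slots σ na 5≤ deg≤ with adj? G z w
    ... | no z≁w = cover-↭ σ (pairsCover (z≁w ∷ na))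
    ... | yes z~w = augmentingCover slots na σ 5≤ (deg≤ z) (deg≤ w)
      where open Augmentation z~w

    exceptionalCover : ∀ {v b₁ ps} R → allFin n ↭ v ∷ b₁ ∷ ends ps ++ R → All (v ~_) R → length R ≡ 4 →
                       v ≁ b₁ → All NonAdjacent ps → 3 ≤ length ps → (∀ u → degree G u ≤ 4 + length ps) →
                       PairCover (3 + length ps) (allFin n)
    exceptionalCover {v} {b₁} {ps} (r₁ ∷ r₂ ∷ r₃ ∷ r₄ ∷ []) σ v~R refl v≁b₁ na 3≤ deg≤
      with x , y , z , w , τ , x≁y ← nonAdjacentPair v~R =
      absorbTwoVertices ((v , b₁) ∷ (x , y) ∷ ps) σ′ (v≁b₁ ∷ x≁y ∷ na) (s≤s (s≤s 3≤)) deg≤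
      where
      σ′ : allFin n ↭ z ∷ w ∷ v ∷ b₁ ∷ x ∷ y ∷ ends ps
      σ′ = begin
        allFin n                                 ↭⟨ σ ⟩
        v ∷ b₁ ∷ ends ps ++ r₁ ∷ r₂ ∷ r₃ ∷ r₄ ∷ []  ↭⟨ ↭-prep v (↭-prep b₁ (++⁺ˡ (ends ps) τ)) ⟩
        v ∷ b₁ ∷ ends ps ++ x ∷ y ∷ z ∷ w ∷ []      ↭⟨ ↭-prep v (↭-prep b₁ (++-comm (ends ps) _)) ⟩
        v ∷ b₁ ∷ x ∷ y ∷ z ∷ w ∷ ends ps            ↭⟨ shifts (v ∷ b₁ ∷ x ∷ y ∷ []) (z ∷ w ∷ []) ⟩
        z ∷ w ∷ v ∷ b₁ ∷ x ∷ y ∷ ends ps            ∎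
        where open PermutationReasoning

    coverFromMatching : ∀ {v b₁ Bt} → 7 ≤ degree G v → (∀ u → degree G u ≤ degree G v) → v ≁ b₁ → length Bt ≤ 3 →
                        allFin n ↭ v ∷ b₁ ∷ Bt ++ neighbours v → Matching (λ b → ∁? (adj? G b)) Bt (neighbours v) →
                        PairCover (degree G v ∸ 1) (allFin n)
    coverFromMatching {v} {b₁} {Bt} 7≤d deg≤ v≁b₁ |Bt|≤3 σ M = byCases (5 ≤? length unmatched)
      where
      open Matching M
      σ′ : allFin n ↭ v ∷ b₁ ∷ ends pairs ++ unmatched
      σ′ = ↭-trans σ (↭-prep v (↭-prep b₁ ++-↭-ends++unmatched))
      v~R : All (v ~_) unmatched
      v~R = All-unmatched (all-filter (adj? G v) (allFin n))

      byCases : Dec (5 ≤ length unmatched) → PairCover (degree G v ∸ 1) (allFin n)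
      byCases (yes 5≤R) = cover-↭ σ′ (cover-≤ (≤-reflexive size≡)
          (pairCover v≁b₁ ++ᶜ pairsCover related ++ᶜ neighbourhoodCover unmatched v~R uR 5≤R))
        where
        uR = Unique-unmatched (Unique-filter⁺ (adj? G v) (allFin⁺ n))
        size≡ : suc (length pairs + (length unmatched ∸ 2)) ≡ degree G v ∸ 1
        size≡ = ≡.trans (sym (+-∸-assoc (suc (length pairs)) (≤-trans (s≤s (s≤s z≤n)) 5≤R)))
                        (cong (_∸ 1) length-pairs+length-unmatched)
      byCases (no 5≰R) = cover-≤ (≤-reflexive size≡)
          (exceptionalCover unmatched σ′ v~R |R|≡4 v≁b₁ related (≤-reflexive (sym |pairs|≡3)) deg≤′)
        where
        counts = p≤3∧r≤4∧7≤p+r⇒p≡3∧r≡4 (≤-trans (≤-reflexive length-pairs) |Bt|≤3) (s≤s⁻¹ (≰⇒> 5≰R))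
                   (≤-trans 7≤d (≤-reflexive (sym length-pairs+length-unmatched)))
        |pairs|≡3 = proj₁ counts
        |R|≡4 = proj₂ counts
        deg≤′ : ∀ u → degree G u ≤ 4 + length pairs
        deg≤′ u = ≤-trans (deg≤ u) (≤-reflexive (≡.trans (sym length-pairs+length-unmatched)
                    (≡.trans (cong (length pairs +_) |R|≡4) (+-comm (length pairs) 4))))
        size≡ : 3 + length pairs ≡ degree G v ∸ 1
        size≡ = ≡.trans (cong (3 +_) |pairs|≡3)
                  (cong (_∸ 1) (≡.trans (sym (cong₂ _+_ |pairs|≡3 |R|≡4)) length-pairs+length-unmatched))

    coverFromMaxDegreeVertex : ∀ {v} → 7 ≤ degree G v → (∀ u → degree G u ≤ degree G v) →
                  ∀ B → allFin n ↭ v ∷ B ++ neighbours v → All (v ≁_) B → PairCover (degree G v ∸ 1) (allFin n)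
    coverFromMaxDegreeVertex {v} 7≤d _ [] σ _ =
      cover-↭ σ (cover-≤ (≤-reflexive (sym (+-∸-assoc 1 (≤-trans (s≤s (s≤s z≤n)) 7≤d))))
        (singletonCover v ++ᶜ neighbourhoodCover (neighbours v) v~N uN (≤-trans 5≤7 7≤d)))
      where
      v~N = all-filter (adj? G v) (allFin n)
      uN = Unique-filter⁺ (adj? G v) (allFin⁺ n)
      5≤7 : 5 ≤ 7
      5≤7 = s≤s (s≤s (s≤s (s≤s (s≤s z≤n))))
    coverFromMaxDegreeVertex {v} 7≤d deg≤ (b₁ ∷ Bt) σ v≁B@(v≁b₁ ∷ _) =
      coverFromMatching 7≤d deg≤ v≁b₁ (s≤s⁻¹ (ω≤4 (b₁ ∷ Bt) (clique-unique clique , clique))) σ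
        (greedyMatching (λ b → ∁? (adj? G b)) Bt (neighbours v) enough)
      where
      clique : AllPairs _~_ (b₁ ∷ Bt)
      clique = non-neighbours-clique v≁B (Unique-++⁻ˡ (v ∷ b₁ ∷ Bt) (Unique-resp-↭ σ (allFin⁺ n)))
      enough : ∀ {b} → b ∈ Bt → length Bt ≤ length (filter (∁? (adj? G b)) (neighbours v))
      enough b∈ = s≤s⁻¹ (length-filter-∁-neighbours σ v≁B clique (there b∈) (deg≤ _))

    pairCover-maxDegree∸1 : 7 ≤ maxDegree G → PairCover (maxDegree G ∸ 1) (allFin n)
    pairCover-maxDegree∸1 7≤Δ with v , deg-v ← maxDegree-attained (≤-trans (s≤s z≤n) 7≤Δ)
                       with B , σ , v≁B ← non-neighbours-split v =
      subst (λ d → PairCover (d ∸ 1) (allFin n)) deg-v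
        (coverFromMaxDegreeVertex (≤-trans 7≤Δ Δ≤d) (λ u → ≤-trans (degree≤maxDegree u) Δ≤d) B σ v≁B)
      where
      Δ≤d = ≤-reflexive (sym deg-v)

mainTheorem1 : ∀ (n : ℕ) (G : Graph n) → ThreeK1Free G →
    CliqueNumberIs G 4 → 7 ≤ maxDegree G →
    ChromaticAtMost G (maxDegree G ∸ 1)
mainTheorem1 n G 3K₁-free (_ , ω≤4) 7≤Δ = colouring G (pairCover-maxDegree∸1 G 3K₁-free ω≤4 7≤Δ)
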